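{- Let $\mathcal{T}$ be a labeled tree and $k\ge 0$ an integer. Then $$|\mathcal{T}|\,H_k(\mathcal{T}\mid L)\le |\mathcal{T}|\,H(\mathcal{T})\qquad\text{and}\qquad |\mathcal{T}|\,H_k(L\mid \mathcal{T})\le |\mathcal{T}|\,H_k(L).$$
   Context: All logarithms are base $2$. A labeled tree $\mathcal{T}$ is a rooted, ordered tree (the children of each node have a left-to-right order) in which each node $v$ carries a label $l_v$ from a finite alphabet $\Sigma$; $|\mathcal{T}|$ is the number of nodes and $d_v$ is the number of children of $v$ (its degree). For a fixed integer $k\ge0$, the context $K_v$ of a node $v$ is the string of labels of the (at most) $k$ nearest proper ancestors of $v$, listed from top to bottom; if $v$ has fewer than $k$ proper ancestors, $K_v$ consists of the labels of all of them. For a context $K$, a label $a$ and an integer $d$, let $t_K$, $t_{K,a}$, $t_{K,d}$, $t_{K,a,d}$ denote the number of nodes of $\mathcal{T}$ having context $K$; context $K$ and label $a$; context $K$ and degree $d$; context $K$, label $a$ and degree $d$, respectively. Define $|\mathcal{T}|H_k(L)=-\sum_{v}\log\frac{t_{K_v,l_v}}{t_{K_v}}$ ($k$-th order label entropy); $|\mathcal{T}|H(\mathcal{T})=-\sum_{i\ge0} n_i\log\frac{n_i}{|\mathcal{T}|}$, where $n_i$ is the number of nodes of degree $i$ (tree entropy); $|\mathcal{T}|H_k(L\mid\mathcal{T})=-\sum_v\log\frac{t_{K_v,l_v,d_v}}{t_{K_v,d_v}}$; $|\mathcal{T}|H_k(\mathcal{T}\mid L)=-\sum_v\log\frac{t_{K_v,l_v,d_v}}{t_{K_v,l_v}}$;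 all sums are over the nodes $v$ of $\mathcal{T}$. -}

module Defs where

open import Data.Nat using (ℕ; zero; suc; _+_; _*_; _^_; _≤_) renaming (_≟_ to _≟ℕ_)
open import Data.Fin using (Fin) renaming (_≟_ to _≟F_)
open import Data.List using (List; []; _∷_; _++_; length; take; reverse)
open import Data.List.Properties using (≡-dec)
open import Data.Product using (_×_; _,_)
open import Data.Bool using (Bool; true; false; _∧_)
open import Relation.Nullary.Decidable using (⌊_⌋)

data Tree (A : Set) : Set where
  node : A → List (Tree A) → Tree A

Ctx : ℕ → Set
Ctx σ = List (Fin σ)

-- Per-node information: (context K_v , label l_v , degree d_v).
NodeInfo : ℕ → Set
NodeInfo σ = Ctx σ × Fin σ × ℕ

-- 'anc' is the list of labels of the proper ancestors, nearest first.
-- The context is the k nearest ones, listed top to bottom.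
mutual
  nodesT : ∀ {σ} → ℕ → Ctx σ → Tree (Fin σ) → List (NodeInfo σ)
  nodesT k anc (node a ts) = (reverse (take k anc) , a , length ts) ∷ nodesF k (a ∷ anc) ts

  nodesF : ∀ {σ} → ℕ → Ctx σ → List (Tree (Fin σ)) → List (NodeInfo σ)
  nodesF k anc [] = []
  nodesF k anc (t ∷ ts) = nodesT k anc t ++ nodesF k anc ts

nodes : ∀ {σ} → ℕ → Tree (Fin σ) → List (NodeInfo σ)
nodes k T = nodesT k [] T

size : ∀ {σ} → Tree (Fin σ) → ℕ
size T = length (nodes 0 T)

countB : ∀ {A : Set} → (A → Bool) → List A → ℕ
countB p [] = 0
countB p (x ∷ xs) with p x
... | true  = suc (countB p xs)
... | false = countB p xs

prodOver : ∀ {A : Set} → (A → ℕ) → List A → ℕ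
prodOver f [] = 1
prodOver f (x ∷ xs) = f x * prodOver f xs

module _ {σ : ℕ} where
  eqC : Ctx σ → Ctx σ → Bool
  eqC K K' = ⌊ ≡-dec _≟F_ K K' ⌋

  eqL : Fin σ → Fin σ → Bool
  eqL a a' = ⌊ a ≟F a' ⌋

  eqD : ℕ → ℕ → Bool
  eqD d d' = ⌊ d ≟ℕ d' ⌋

  tK : List (NodeInfo σ) → Ctx σ → ℕ
  tK ns K = countB (λ { (K' , _ , _) → eqC K K' }) ns

  tKa : List (NodeInfo σ) → Ctx σ → Fin σ → ℕ
  tKa ns K a = countB (λ { (K' , a' , _) → eqC K K' ∧ eqL a a' }) ns

  tKd : List (NodeInfo σ) → Ctx σ → ℕ → ℕ
  tKd ns K d = countB (λ { (K' , _ , d') → eqC K K' ∧ eqD d d' }) ns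

  tKad : List (NodeInfo σ) → Ctx σ → Fin σ → ℕ → ℕ
  tKad ns K a d = countB (λ { (K' , a' , d') → eqC K K' ∧ eqL a a' ∧ eqD d d' }) ns

  nDeg : List (NodeInfo σ) → ℕ → ℕ
  nDeg ns i = countB (λ { (_ , _ , d) → eqD i d }) ns

record Frac : Set where
  constructor _⁄_
  field
    num : ℕ
    den : ℕ

_≤F_ : Frac → Frac → Set
(a ⁄ b) ≤F (c ⁄ d) = a * d ≤ c * b

-- Exponentiated entropies: for an entropy quantity X = -Σ_v log(p_v / q_v) we represent
-- 2^(-X) = Π_v p_v / Π_v q_v exactly.  Since x ↦ 2^(-x) is strictly decreasing,
-- X ≤ Y  iff  2^(-Y) ≤ 2^(-X).

-- 2^(-|T| H_k(L))      = Π_v t_{K_v,l_v} / t_{K_v}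
exp2-HkL : ∀ {σ} → ℕ → Tree (Fin σ) → Frac
exp2-HkL k T = let ns = nodes k T in
  prodOver (λ { (K , a , d) → tKa ns K a }) ns ⁄ prodOver (λ { (K , a , d) → tK ns K }) ns

-- 2^(-|T| H(T))        = Π_i (n_i / |T|)^{n_i} = Π_v n_{d_v} / |T|
exp2-HT : ∀ {σ} → Tree (Fin σ) → Frac
exp2-HT T = let ns = nodes 0 T in
  prodOver (λ { (K , a , d) → nDeg ns d }) ns ⁄ (length ns ^ length ns)

-- 2^(-|T| H_k(L | T))  = Π_v t_{K_v,l_v,d_v} / t_{K_v,d_v}
exp2-HkL∣T : ∀ {σ} → ℕ → Tree (Fin σ) → Frac
exp2-HkL∣T k T = let ns = nodes k T in
  prodOver (λ { (K , a , d) → tKad ns K a d }) ns ⁄ prodOver (λ { (K , a , d) → tKd ns K d }) ns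

-- 2^(-|T| H_k(T | L))  = Π_v t_{K_v,l_v,d_v} / t_{K_v,l_v}
exp2-HkT∣L : ∀ {σ} → ℕ → Tree (Fin σ) → Frac
exp2-HkT∣L k T = let ns = nodes k T in
  prodOver (λ { (K , a , d) → tKad ns K a d }) ns ⁄ prodOver (λ { (K , a , d) → tKa ns K a }) ns

-- Write c_E(v) for the number of nodes in the E-class of v.  For an empirical entropy H of a
-- partition E of the nodes, 2^(-|T| H) = Π_v c_E(v) / |T|^|T|, so both inequalities are
-- inequalities between products of class counts.  With K, L, D the partitions by context, label
-- and degree, the first one is subadditivity H(K,L,D) ≤ H(K,L) + H(D), where H(D) = H(T) because
-- the degree sequence does not depend on k; the second one is strong subadditivity
-- H(K,L,D) + H(K) ≤ H(K,L) + H(K,D).  Splitting off one class at a time reduces both to Gibbs'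
-- inequality Π_j g_j^(h_j) · (Σ h)^(Σ h) ≤ Π_j h_j^(h_j) · (Σ g)^(Σ h), which is assembled from
-- the two-term weighted AM-GM inequality; that in turn is AM-GM for lists, proved by induction
-- with Bernoulli's inequality.
module Submission where

open import Defs
open import Algebra.Properties.CommutativeSemigroup using (interchange; x∙yz≈y∙xz)
open import Data.Bool using (Bool; true; false; T; _∧_)
open import Data.Bool.Properties using (∧-assoc; ∧-comm)
open import Data.Fin using (Fin) renaming (_≟_ to _≟F_)
open import Data.List using (List; []; _∷_; _++_; length; map; filter; replicate)
open import Data.List.Properties
  using (≡-dec; length-++; length-map; length-replicate; length-filter; filter-reject; map-++)
open import Data.List.Relation.Unary.All as All using (All; []; _∷_)
open import Data.List.Relation.Unary.All.Properties using (all-filter)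
open import Data.Nat using (ℕ; zero; suc; _+_; _*_; _^_; _≤_; s≤s; NonZero) renaming (_≟_ to _≟ℕ_)
open import Data.Nat.ListAction using (sum; product)
open import Data.Nat.ListAction.Properties using (sum-++; product-++)
open import Data.Nat.Properties
  using ( *-commutativeSemigroup; +-comm; +-suc; +-identityʳ; *-assoc; *-identityˡ; *-identityʳ
        ; ≤-refl; ≤-reflexive; ≤-trans; ≤-total; m≤m+n; m≤n+m; m≤n⇒∃[o]m+o≡n
        ; +-monoˡ-≤; *-monoʳ-≤; *-monoˡ-≤; *-mono-≤; ^-monoˡ-≤
        ; +-cancelʳ-≤; *-cancelˡ-≤; *-cancelʳ-≤
        ; m*n≢0; m^n≢0; ^-distribˡ-+-*; module ≤-Reasoning )
open import Data.Nat.Tactic.RingSolver using (solve-∀)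
open import Data.Product using (_×_; _,_; proj₁; proj₂)
open import Data.Sum using (inj₁; inj₂)
open import Function using (_∘_; id)
open import Level using (0ℓ)
open import Relation.Binary.Definitions using (DecidableEquality)
open import Relation.Binary.Structures using (IsEquivalence)
open import Relation.Binary.PropositionalEquality as ≡ using (_≡_; refl; cong; cong₂; subst)
open import Relation.Nullary using (¬_; contradiction; yes; no)
open import Relation.Nullary.Decidable using (⌊_⌋; T?; toWitness; fromWitness)
open import Relation.Unary using (Pred; Decidable)
open import Relation.Unary.Properties using (∁?)

open ≤-Reasoning

private variable
  A B : Set

-- Power inequalities

^-distrib-* : ∀ m n o → (m * n) ^ o ≡ m ^ o * n ^ o
^-distrib-* m n zero    = refl
^-distrib-* m n (suc o) = begin-equality
  m * n * (m * n) ^ o      ≡⟨ cong (m * n *_) (^-distrib-* m n o) ⟩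
  m * n * (m ^ o * n ^ o)  ≡⟨ interchange *-commutativeSemigroup m n (m ^ o) (n ^ o) ⟩
  m * m ^ o * (n * n ^ o)  ∎

n^n≢0 : ∀ n → NonZero (n ^ n)
n^n≢0 zero    = _
n^n≢0 (suc n) = m^n≢0 (suc n) (suc n)

rearrangement : ∀ {x y u v} → x ≤ y → u ≤ v → x * v + y * u ≤ x * u + y * v
rearrangement {x} {u = u} x≤y u≤v with m≤n⇒∃[o]m+o≡n x≤y | m≤n⇒∃[o]m+o≡n u≤v
... | d , refl | e , refl = begin
  x * (u + e) + (x + d) * u          ≤⟨ m≤m+n _ (d * e) ⟩
  x * (u + e) + (x + d) * u + d * e  ≡⟨ expand x u d e ⟩
  x * u + (x + d) * (u + e)          ∎
  where
  expand : ∀ x u d e → x * (u + e) + (x + d) * u + d * e ≡ x * u + (x + d) * (u + e)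
  expand = solve-∀

powers-rearrangement : ∀ n a b → a ^ n * b + b ^ n * a ≤ a ^ n * a + b ^ n * b
powers-rearrangement n a b with ≤-total a b
... | inj₁ a≤b = rearrangement (^-monoˡ-≤ n a≤b) a≤b
... | inj₂ b≤a = begin
  a ^ n * b + b ^ n * a  ≡⟨ +-comm (a ^ n * b) (b ^ n * a) ⟩
  b ^ n * a + a ^ n * b  ≤⟨ rearrangement (^-monoˡ-≤ n b≤a) b≤a ⟩
  b ^ n * b + a ^ n * a  ≡⟨ +-comm (b ^ n * b) (a ^ n * a) ⟩
  a ^ n * a + b ^ n * b  ∎

-- Homogeneous form of Bernoulli's inequality (weighted AM-GM with weights 1 and n).
bernoulli : ∀ n a b → suc n * (a * b ^ n) ≤ a ^ suc n + n * b ^ suc n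
bernoulli zero    a b = ≤-refl
bernoulli (suc n) a b = begin
  (2 + n) * (a * (b * b ^ n))                            ≡⟨ peel n a b (b ^ n) ⟩
  b * ((1 + n) * (a * b ^ n)) + a * (b * b ^ n)          ≤⟨ +-monoˡ-≤ _ (*-monoʳ-≤ b (bernoulli n a b)) ⟩
  b * (a ^ suc n + n * b ^ suc n) + a * b ^ suc n        ≡⟨ regroup n a b (a ^ suc n) (b ^ suc n) ⟩
  (a ^ suc n * b + b ^ suc n * a) + n * (b * b ^ suc n)  ≤⟨ +-monoˡ-≤ _ (powers-rearrangement (suc n) a b) ⟩
  (a ^ suc n * a + b ^ suc n * b) + n * (b * b ^ suc n)  ≡⟨ collect n a b (a ^ suc n) (b ^ suc n) ⟩
  a * a ^ suc n + (1 + n) * (b * b ^ suc n)              ∎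
  where
  peel : ∀ n a b p → (2 + n) * (a * (b * p)) ≡ b * ((1 + n) * (a * p)) + a * (b * p)
  peel = solve-∀
  regroup : ∀ n a b p q → b * (p + n * q) + a * q ≡ (p * b + q * a) + n * (b * q)
  regroup = solve-∀
  collect : ∀ n a b p q → (p * a + q * b) + n * (b * q) ≡ a * p + (1 + n) * (b * q)
  collect = solve-∀

-- Bernoulli at a = n (x + s), b = (n + 1) s, after cancelling the common summand n (n+1)^(n+1) s^(n+1).
amgm-step : ∀ n x s → suc n ^ suc n * (x * s ^ n) ≤ n ^ n * (x + s) ^ suc n
amgm-step zero      x s = *-monoʳ-≤ 1 (*-monoˡ-≤ 1 (m≤m+n x s))
amgm-step n@(suc _) x s = *-cancelˡ-≤ n (+-cancelʳ-≤ C _ _ (begin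
  n * (suc n ^ suc n * (x * s ^ n)) + C  ≡⟨ expand n x s (suc n ^ n) (s ^ n) ⟩
  suc n * (a * (suc n ^ n * s ^ n))      ≡⟨ cong (λ z → suc n * (a * z)) (^-distrib-* (suc n) s n) ⟨
  suc n * (a * b ^ n)                    ≤⟨ bernoulli n a b ⟩
  a ^ suc n + n * (b * b ^ n)            ≡⟨ cong₂ (λ y z → y + n * (b * z)) (^-distrib-* n (x + s) (suc n))
                                                                           (^-distrib-* (suc n) s n) ⟩
  n ^ suc n * (x + s) ^ suc n + C        ≡⟨ cong (_+ C) (*-assoc n (n ^ n) ((x + s) ^ suc n)) ⟩
  n * (n ^ n * (x + s) ^ suc n) + C      ∎))
  where
  a b C : ℕ
  a = n * (x + s)
  b = suc n * s
  C = n * (b * (suc n ^ n * s ^ n))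
  expand : ∀ n x s p t →
    n * ((1 + n) * p * (x * t)) + n * ((1 + n) * s * (p * t)) ≡ (1 + n) * (n * (x + s) * (p * t))
  expand = solve-∀

amgm : ∀ xs → length xs ^ length xs * product xs ≤ sum xs ^ length xs
amgm []       = ≤-refl
amgm (x ∷ xs) = *-cancelˡ-≤ (n ^ n) {{n^n≢0 n}} (begin
  n ^ n * (suc n ^ suc n * (x * product xs))  ≡⟨ swap (n ^ n) (suc n ^ suc n) x (product xs) ⟩
  suc n ^ suc n * (x * (n ^ n * product xs))  ≤⟨ *-monoʳ-≤ (suc n ^ suc n) (*-monoʳ-≤ x (amgm xs)) ⟩
  suc n ^ suc n * (x * sum xs ^ n)            ≤⟨ amgm-step n x (sum xs) ⟩
  n ^ n * (x + sum xs) ^ suc n                ∎)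
  where
  n : ℕ
  n = length xs
  swap : ∀ a b c d → a * (b * (c * d)) ≡ b * (c * (a * d))
  swap = solve-∀

sum-replicate : ∀ n c → sum (replicate n c) ≡ n * c
sum-replicate zero    c = refl
sum-replicate (suc n) c = cong (c +_) (sum-replicate n c)

product-replicate : ∀ n c → product (replicate n c) ≡ c ^ n
product-replicate zero    c = refl
product-replicate (suc n) c = cong (c *_) (product-replicate n c)

amgm-two-values : ∀ a b u v → (a + b) ^ (a + b) * (u ^ a * v ^ b) ≤ (a * u + b * v) ^ (a + b)
amgm-two-values a b u v = begin
  (a + b) ^ (a + b) * (u ^ a * v ^ b)  ≡⟨ cong ((a + b) ^ (a + b) *_) product-xs ⟨
  (a + b) ^ (a + b) * product xs       ≤⟨ subst (λ n → n ^ n * product xs ≤ sum xs ^ n) length-xs (amgm xs) ⟩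
  sum xs ^ (a + b)                     ≡⟨ cong (_^ (a + b)) sum-xs ⟩
  (a * u + b * v) ^ (a + b)            ∎
  where
  xs : List ℕ
  xs = replicate a u ++ replicate b v
  length-xs : length xs ≡ a + b
  length-xs = ≡.trans (length-++ (replicate a u)) (cong₂ _+_ (length-replicate a) (length-replicate b))
  product-xs : product xs ≡ u ^ a * v ^ b
  product-xs = ≡.trans (product-++ (replicate a u) (replicate b v))
                       (cong₂ _*_ (product-replicate a u) (product-replicate b v))
  sum-xs : sum xs ≡ a * u + b * v
  sum-xs = ≡.trans (sum-++ (replicate a u) (replicate b v)) (cong₂ _+_ (sum-replicate a u) (sum-replicate b v))

-- For positive weights: AM-GM for a copies of x·b and b copies of y·a, divided by b^a · a^b.
weighted-amgm : ∀ a b x y → (a + b) ^ (a + b) * (x ^ a * y ^ b) ≤ (a ^ a * b ^ b) * (x + y) ^ (a + b)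
weighted-amgm zero b x y = begin
  b ^ b * (1 * y ^ b)        ≡⟨ cong (b ^ b *_) (*-identityˡ (y ^ b)) ⟩
  b ^ b * y ^ b              ≤⟨ *-monoʳ-≤ (b ^ b) (^-monoˡ-≤ b (m≤n+m y x)) ⟩
  b ^ b * (x + y) ^ b        ≡⟨ cong (_* (x + y) ^ b) (*-identityˡ (b ^ b)) ⟨
  (1 * b ^ b) * (x + y) ^ b  ∎
weighted-amgm a zero x y rewrite +-identityʳ a = begin
  a ^ a * (x ^ a * 1)        ≡⟨ cong (a ^ a *_) (*-identityʳ (x ^ a)) ⟩
  a ^ a * x ^ a              ≤⟨ *-monoʳ-≤ (a ^ a) (^-monoˡ-≤ a (m≤m+n x y)) ⟩
  a ^ a * (x + y) ^ a        ≡⟨ cong (_* (x + y) ^ a) (*-identityʳ (a ^ a)) ⟨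
  (a ^ a * 1) * (x + y) ^ a  ∎
weighted-amgm a@(suc _) b@(suc _) x y =
  *-cancelʳ-≤ _ _ (b ^ a * a ^ b) {{m*n≢0 (b ^ a) (a ^ b) {{m^n≢0 b a}} {{m^n≢0 a b}}}} (begin
    (a + b) ^ (a + b) * (x ^ a * y ^ b) * (b ^ a * a ^ b)
      ≡⟨ ≡.trans (*-assoc ((a + b) ^ (a + b)) _ _) (cong ((a + b) ^ (a + b) *_) scale) ⟩
    (a + b) ^ (a + b) * ((x * b) ^ a * (y * a) ^ b)
      ≤⟨ amgm-two-values a b (x * b) (y * a) ⟩
    (a * (x * b) + b * (y * a)) ^ (a + b)
      ≡⟨ cong (_^ (a + b)) (factor a b x y) ⟩
    (a * b * (x + y)) ^ (a + b)
      ≡⟨ ≡.trans (^-distrib-* (a * b) (x + y) (a + b)) (cong (_* (x + y) ^ (a + b)) (^-distrib-* a b (a + b))) ⟩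
    a ^ (a + b) * b ^ (a + b) * (x + y) ^ (a + b)
      ≡⟨ cong (_* (x + y) ^ (a + b)) (cong₂ _*_ (^-distribˡ-+-* a a b) (^-distribˡ-+-* b a b)) ⟩
    (a ^ a * a ^ b) * (b ^ a * b ^ b) * (x + y) ^ (a + b)
      ≡⟨ regroup (a ^ a) (a ^ b) (b ^ a) (b ^ b) ((x + y) ^ (a + b)) ⟩
    (a ^ a * b ^ b) * (x + y) ^ (a + b) * (b ^ a * a ^ b) ∎)
  where
  scale : x ^ a * y ^ b * (b ^ a * a ^ b) ≡ (x * b) ^ a * (y * a) ^ b
  scale = ≡.trans (interchange *-commutativeSemigroup (x ^ a) (y ^ b) (b ^ a) (a ^ b))
                  (≡.sym (cong₂ _*_ (^-distrib-* x b a) (^-distrib-* y a b)))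
  factor : ∀ a b x y → a * (x * b) + b * (y * a) ≡ a * b * (x + y)
  factor = solve-∀
  regroup : ∀ p q r s t → (p * q) * (r * s) * t ≡ (p * s) * t * (r * q)
  regroup = solve-∀

-- The induction step of Gibbs' inequality: a new class with k members in the sample and q in the
-- reference is added to the rest (o in the sample, Q in the reference, likelihoods A and B).
gibbs-step : ∀ q Q A B k o → A * o ^ o ≤ B * Q ^ o →
             (q ^ k * A) * (k + o) ^ (k + o) ≤ (k ^ k * B) * (q + Q) ^ (k + o)
gibbs-step q Q A B k o rest = *-cancelʳ-≤ _ _ (o ^ o) {{n^n≢0 o}} (begin
  (q ^ k * A) * (k + o) ^ (k + o) * o ^ o    ≡⟨ regroup₁ (q ^ k) A ((k + o) ^ (k + o)) (o ^ o) ⟩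
  (q ^ k * (k + o) ^ (k + o)) * (A * o ^ o)  ≤⟨ *-monoʳ-≤ (q ^ k * (k + o) ^ (k + o)) rest ⟩
  (q ^ k * (k + o) ^ (k + o)) * (B * Q ^ o)  ≡⟨ regroup₂ (q ^ k) ((k + o) ^ (k + o)) B (Q ^ o) ⟩
  B * ((k + o) ^ (k + o) * (q ^ k * Q ^ o))  ≤⟨ *-monoʳ-≤ B (weighted-amgm k o q Q) ⟩
  B * ((k ^ k * o ^ o) * (q + Q) ^ (k + o))  ≡⟨ regroup₃ B (k ^ k) (o ^ o) ((q + Q) ^ (k + o)) ⟩
  (k ^ k * B) * (q + Q) ^ (k + o) * o ^ o    ∎)
  where
  regroup₁ : ∀ u a w p → (u * a) * w * p ≡ (u * w) * (a * p)
  regroup₁ = solve-∀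
  regroup₂ : ∀ u w b r → (u * w) * (b * r) ≡ b * (w * (u * r))
  regroup₂ = solve-∀
  regroup₃ : ∀ b s p t → b * ((s * p) * t) ≡ (s * b) * t * p
  regroup₃ = solve-∀

-- Counting in lists

prodOver-cong : ∀ {f g : A → ℕ} {xs} → All (λ x → f x ≡ g x) xs → prodOver f xs ≡ prodOver g xs
prodOver-cong []       = refl
prodOver-cong (e ∷ es) = cong₂ _*_ e (prodOver-cong es)

prodOver-const : ∀ {f : A → ℕ} {c xs} → All (λ x → f x ≡ c) xs → prodOver f xs ≡ c ^ length xs
prodOver-const []       = refl
prodOver-const (e ∷ es) = cong₂ _*_ e (prodOver-const es)

prodOver-map : ∀ (g : B → ℕ) (f : A → B) xs → prodOver g (map f xs) ≡ prodOver (g ∘ f) xs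
prodOver-map g f []       = refl
prodOver-map g f (x ∷ xs) = cong (g (f x) *_) (prodOver-map g f xs)

countB-cong : ∀ {p q : A → Bool} {xs} → All (λ x → p x ≡ q x) xs → countB p xs ≡ countB q xs
countB-cong []                         = refl
countB-cong {p = p} {q} {x ∷ _} (e ∷ es) with p x | q x | e
... | true  | .true  | refl = cong suc (countB-cong es)
... | false | .false | refl = countB-cong es

countB-all : ∀ {p : A → Bool} {xs} → All (T ∘ p) xs → countB p xs ≡ length xs
countB-all []                           = refl
countB-all {p = p} {x ∷ _} (px ∷ pxs) with p x
... | true = cong suc (countB-all pxs)

countB-map : ∀ (p : B → Bool) (f : A → B) xs → countB p (map f xs) ≡ countB (p ∘ f) xs
countB-map p f []       = refl
countB-map p f (x ∷ xs) with p (f x)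
... | true  = cong suc (countB-map p f xs)
... | false = countB-map p f xs

module _ {P : Pred A 0ℓ} (P? : Decidable P) where

  prodOver-filter : ∀ (f : A → ℕ) xs →
                    prodOver f xs ≡ prodOver f (filter P? xs) * prodOver f (filter (∁? P?) xs)
  prodOver-filter f []       = refl
  prodOver-filter f (x ∷ xs) with P? x
  ... | yes _ = ≡.trans (cong (f x *_) (prodOver-filter f xs)) (≡.sym (*-assoc (f x) _ _))
  ... | no  _ = ≡.trans (cong (f x *_) (prodOver-filter f xs))
                        (x∙yz≈y∙xz *-commutativeSemigroup (f x) (prodOver f (filter P? xs)) _)

  length-filter-∁ : ∀ (xs : List A) → length xs ≡ length (filter P? xs) + length (filter (∁? P?) xs)
  length-filter-∁ []       = refl
  length-filter-∁ (x ∷ xs) with P? x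
  ... | yes _ = cong suc (length-filter-∁ xs)
  ... | no  _ = ≡.trans (cong suc (length-filter-∁ xs)) (≡.sym (+-suc _ _))

  countB-filter : ∀ {p : A → Bool} → (∀ {x} → T (p x) → P x) →
                  ∀ xs → countB p xs ≡ countB p (filter P? xs)
  countB-filter p⇒P [] = refl
  countB-filter {p} p⇒P (x ∷ xs) with P? x
  ... | yes _ with p x
  ...   | true  = cong suc (countB-filter p⇒P xs)
  ...   | false = countB-filter p⇒P xs
  countB-filter {p} p⇒P (x ∷ xs) | no ¬Px with p x in px
  ...   | true  = contradiction (p⇒P (subst T (≡.sym px) _)) ¬Px
  ...   | false = countB-filter p⇒P xs

-- Class counts of Boolean equivalences

T-∧-intro : ∀ {x y} → T x → T y → T (x ∧ y)
T-∧-intro {true} _ q = q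

T-∧-proj₁ : ∀ {x y} → T (x ∧ y) → T x
T-∧-proj₁ {true} _ = _

T-∧-proj₂ : ∀ {x y} → T (x ∧ y) → T y
T-∧-proj₂ {true} q = q

T⇒∧-identityˡ : ∀ {x} y → T x → x ∧ y ≡ y
T⇒∧-identityˡ {true} y _ = refl

∧-rotate : ∀ x y z → x ∧ (y ∧ z) ≡ y ∧ (z ∧ x)
∧-rotate x y z = ≡.trans (∧-comm x (y ∧ z)) (∧-assoc y z x)

-- Partitions are Boolean-valued tests, so that the meet of the partitions by context, label and
-- degree is literally the conjunction of tests in the counts t_K, t_{K,a}, t_{K,d}, t_{K,a,d}.
record BoolEquivalence (A : Set) : Set where
  infix 4 _==_ _≈_ _≈?_
  field
    _==_          : A → A → Bool
    isEquivalence : IsEquivalence (λ v w → T (v == w))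

  _≈_ : A → A → Set
  v ≈ w = T (v == w)

  _≈?_ : ∀ v → Decidable (v ≈_)
  v ≈? w = T? (v == w)

  open IsEquivalence isEquivalence public
    renaming (refl to ≈-refl; sym to ≈-sym; trans to ≈-trans)

kernel : (f : A → B) → DecidableEquality B → BoolEquivalence A
kernel f _≟_ = record
  { _==_          = λ v w → ⌊ f v ≟ f w ⌋
  ; isEquivalence = record
    { refl  = λ {v} → fromWitness {a? = f v ≟ f v} refl
    ; sym   = λ {v} {w} p → fromWitness {a? = f w ≟ f v} (≡.sym (toWitness p))
    ; trans = λ {u} {v} {w} p q → fromWitness {a? = f u ≟ f w} (≡.trans (toWitness p) (toWitness q))
    }
  }

infixr 6 _⊓_
_⊓_ : BoolEquivalence A → BoolEquivalence A → BoolEquivalence A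
E ⊓ F = record
  { _==_          = λ v w → (v E.== w) ∧ (v F.== w)
  ; isEquivalence = record
    { refl  = λ {v} → T-∧-intro (E.≈-refl {v}) (F.≈-refl {v})
    ; sym   = λ {v} {w} p → T-∧-intro (E.≈-sym (T-∧-proj₁ p)) (F.≈-sym (T-∧-proj₂ {v E.== w} p))
    ; trans = λ {u} {v} {w} p q → T-∧-intro (E.≈-trans (T-∧-proj₁ p) (T-∧-proj₁ q))
                                            (F.≈-trans (T-∧-proj₂ {u E.== v} p) (T-∧-proj₂ {v E.== w} q))
    }
  }
  where
  module E = BoolEquivalence E
  module F = BoolEquivalence F

_Refines_ : BoolEquivalence A → BoolEquivalence A → Set
S Refines E = ∀ {v w} → BoolEquivalence._≈_ S v w → BoolEquivalence._≈_ E v w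

module _ (E : BoolEquivalence A) where
  open BoolEquivalence E

  classSize : List A → A → ℕ
  classSize G v = countB (v ==_) G

  -- likelihood E L L = |L|^|L| · 2^(-|L| H), with H the empirical entropy of the E-classes in L.
  likelihood : List A → List A → ℕ
  likelihood G L = prodOver (classSize G) L

  classOf outside : A → List A → List A
  classOf v = filter (v ≈?_)
  outside v = filter (∁? (v ≈?_))

likelihood-cong : ∀ (E F : BoolEquivalence A) →
                  (∀ v w → BoolEquivalence._==_ E v w ≡ BoolEquivalence._==_ F v w) →
                  ∀ G L → likelihood E G L ≡ likelihood F G L
likelihood-cong E F E==F G L =
  prodOver-cong {xs = L} (All.tabulate (λ {v} _ → countB-cong {xs = G} (All.tabulate (λ {w} _ → E==F v w))))

likelihood-kernel : ∀ (f : A → B) (_≟_ : DecidableEquality B) G L →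
                    likelihood (kernel f _≟_) G L ≡ likelihood (kernel id _≟_) (map f G) (map f L)
likelihood-kernel f _≟_ G L = ≡.trans
  (prodOver-cong {xs = L} (All.tabulate (λ {v} _ → ≡.sym (countB-map (λ y → ⌊ f v ≟ y ⌋) f G))))
  (≡.sym (prodOver-map (classSize (kernel id _≟_) (map f G)) f L))

module _ (E : BoolEquivalence A) where
  open BoolEquivalence E

  class-induction : (P : List A → Set) → P [] →
                    (∀ v L → P (outside E v (v ∷ L)) → P (v ∷ L)) → ∀ L → P L
  class-induction P base step L = go L (length L) ≤-refl
    where
    go : ∀ L n → length L ≤ n → P L
    go []      _       _            = base
    go (v ∷ L) (suc n) (s≤s |L|≤n) = step v L (go _ n (≤-trans shorter |L|≤n))
      where
      shorter : length (outside E v (v ∷ L)) ≤ length L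
      shorter = ≤-trans (≤-reflexive (cong length (filter-reject (∁? (v ≈?_)) (λ v≉v → v≉v ≈-refl))))
                        (length-filter (∁? (v ≈?_)) L)

  length-split : ∀ v L → length L ≡ length (classOf E v L) + length (outside E v L)
  length-split v = length-filter-∁ (v ≈?_)

  module _ (S : BoolEquivalence A) (S⇒E : S Refines E) where

    classSize-classOf : ∀ {v w} → v ≈ w → ∀ G → classSize S G w ≡ classSize S (classOf E v G) w
    classSize-classOf v≈w = countB-filter (_ ≈?_) (λ w~u → ≈-trans v≈w (S⇒E w~u))

    classSize-outside : ∀ {v w} → ¬ v ≈ w → ∀ G → classSize S G w ≡ classSize S (outside E v G) w
    classSize-outside v≉w =
      countB-filter (∁? (_ ≈?_)) (λ w~u v≈u → v≉w (≈-trans v≈u (≈-sym (S⇒E w~u))))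

    likelihood-split : ∀ v G L →
      likelihood S G L ≡ likelihood S (classOf E v G) (classOf E v L) * likelihood S (outside E v G) (outside E v L)
    likelihood-split v G L = ≡.trans (prodOver-filter (v ≈?_) (classSize S G) L) (cong₂ _*_
      (prodOver-cong (All.map (λ v≈w → classSize-classOf v≈w G) (all-filter (v ≈?_) L)))
      (prodOver-cong (All.map (λ v≉w → classSize-outside v≉w G) (all-filter (∁? (v ≈?_)) L))))

  likelihood-classOf : ∀ v G L →
    likelihood E (classOf E v G) (classOf E v L) ≡ length (classOf E v G) ^ length (classOf E v L)
  likelihood-classOf v G L = prodOver-const (All.map
    (λ v≈w → countB-all (All.map (λ v≈u → ≈-trans (≈-sym v≈w) v≈u) (all-filter (v ≈?_) G)))
    (all-filter (v ≈?_) L))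

  likelihood-splitOff : ∀ v G L →
    likelihood E G L ≡ length (classOf E v G) ^ length (classOf E v L) * likelihood E (outside E v G) (outside E v L)
  likelihood-splitOff v G L = ≡.trans (likelihood-split E id v G L)
    (cong (_* likelihood E (outside E v G) (outside E v L)) (likelihood-classOf v G L))

  likelihood-⊓-classOf : ∀ S v G L →
    likelihood (E ⊓ S) (classOf E v G) (classOf E v L) ≡ likelihood S (classOf E v G) (classOf E v L)
  likelihood-⊓-classOf S v G L = prodOver-cong (All.map
    (λ {w} v≈w → countB-cong (All.map
      (λ {u} v≈u → T⇒∧-identityˡ (BoolEquivalence._==_ S w u) (≈-trans (≈-sym v≈w) v≈u))
      (all-filter (v ≈?_) G)))
    (all-filter (v ≈?_) L))

  likelihood-⊓-splitOff : ∀ S v L →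
    likelihood (E ⊓ S) L L ≡
    likelihood S (classOf E v L) (classOf E v L) * likelihood (E ⊓ S) (outside E v L) (outside E v L)
  likelihood-⊓-splitOff S v L = ≡.trans (likelihood-split (E ⊓ S) T-∧-proj₁ v L L)
    (cong (_* likelihood (E ⊓ S) (outside E v L) (outside E v L)) (likelihood-⊓-classOf S v L L))

-- Entropy inequalities

gibbs : (E : BoolEquivalence A) (H G : List A) →
        likelihood E G H * length H ^ length H ≤ likelihood E H H * length G ^ length H
gibbs {A} E H G = class-induction E Gibbs (λ _ → ≤-refl) step H G
  where
  Gibbs : List A → Set
  Gibbs H = ∀ G → likelihood E G H * length H ^ length H ≤ likelihood E H H * length G ^ length H

  step : ∀ v H → Gibbs (outside E v (v ∷ H)) → Gibbs (v ∷ H)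
  step v H rest G = begin
    likelihood E G L * length L ^ length L
      ≡⟨ cong₂ _*_ (likelihood-splitOff E v G L) (cong (λ n → n ^ n) (length-split E v L)) ⟩
    (q ^ k * likelihood E G′ O) * (k + o) ^ (k + o)
      ≤⟨ gibbs-step q (length G′) _ _ k o (rest G′) ⟩
    (k ^ k * likelihood E O O) * (q + length G′) ^ (k + o)
      ≡⟨ cong₂ _*_ (likelihood-splitOff E v L L) (cong₂ _^_ (length-split E v G) (length-split E v L)) ⟨
    likelihood E L L * length G ^ length L ∎
    where
    L O G′ : List A
    q k o : ℕ
    L = v ∷ H
    O = outside E v L
    G′ = outside E v G
    q = length (classOf E v G)
    k = length (classOf E v L)
    o = length O

subadditivity : (X Y : BoolEquivalence A) (G L : List A) →
                likelihood X L L * likelihood Y G L ≤ likelihood (X ⊓ Y) L L * length G ^ length L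
subadditivity {A} X Y G = class-induction X Subadditive ≤-refl step
  where
  Subadditive : List A → Set
  Subadditive L = likelihood X L L * likelihood Y G L ≤ likelihood (X ⊓ Y) L L * length G ^ length L

  step : ∀ v L → Subadditive (outside X v (v ∷ L)) → Subadditive (v ∷ L)
  step v L rest = begin
    likelihood X L′ L′ * likelihood Y G L′
      ≡⟨ cong₂ _*_ (likelihood-splitOff X v L′ L′) (prodOver-filter (v X.≈?_) (classSize Y G) L′) ⟩
    (k ^ k * likelihood X O O) * (likelihood Y G K * likelihood Y G O)
      ≡⟨ regroup (k ^ k) (likelihood X O O) (likelihood Y G K) (likelihood Y G O) ⟩
    (likelihood Y G K * k ^ k) * (likelihood X O O * likelihood Y G O)
      ≤⟨ *-mono-≤ (gibbs Y K G) rest ⟩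
    (likelihood Y K K * length G ^ k) * (likelihood (X ⊓ Y) O O * length G ^ length O)
      ≡⟨ interchange *-commutativeSemigroup (likelihood Y K K) _ (likelihood (X ⊓ Y) O O) _ ⟩
    (likelihood Y K K * likelihood (X ⊓ Y) O O) * (length G ^ k * length G ^ length O)
      ≡⟨ cong₂ _*_ (likelihood-⊓-splitOff X Y v L′)
                   (≡.trans (cong (length G ^_) (length-split X v L′))
                            (^-distribˡ-+-* (length G) k (length O))) ⟨
    likelihood (X ⊓ Y) L′ L′ * length G ^ length L′ ∎
    where
    module X = BoolEquivalence X
    L′ K O : List A
    k : ℕ
    L′ = v ∷ L
    K = classOf X v L′
    O = outside X v L′
    k = length K
    regroup : ∀ a b c d → (a * b) * (c * d) ≡ (c * a) * (b * d)
    regroup = solve-∀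

strongSubadditivity : (Z X Y : BoolEquivalence A) (L : List A) →
  likelihood (Z ⊓ X) L L * likelihood (Z ⊓ Y) L L ≤ likelihood (Z ⊓ (X ⊓ Y)) L L * likelihood Z L L
strongSubadditivity {A} Z X Y = class-induction Z StronglySubadditive ≤-refl step
  where
  StronglySubadditive : List A → Set
  StronglySubadditive L =
    likelihood (Z ⊓ X) L L * likelihood (Z ⊓ Y) L L ≤ likelihood (Z ⊓ (X ⊓ Y)) L L * likelihood Z L L

  step : ∀ v L → StronglySubadditive (outside Z v (v ∷ L)) → StronglySubadditive (v ∷ L)
  step v L rest = begin
    likelihood (Z ⊓ X) L′ L′ * likelihood (Z ⊓ Y) L′ L′
      ≡⟨ cong₂ _*_ (likelihood-⊓-splitOff Z X v L′) (likelihood-⊓-splitOff Z Y v L′) ⟩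
    (likelihood X K K * likelihood (Z ⊓ X) O O) * (likelihood Y K K * likelihood (Z ⊓ Y) O O)
      ≡⟨ interchange *-commutativeSemigroup (likelihood X K K) _ (likelihood Y K K) _ ⟩
    (likelihood X K K * likelihood Y K K) * (likelihood (Z ⊓ X) O O * likelihood (Z ⊓ Y) O O)
      ≤⟨ *-mono-≤ (subadditivity X Y K K) rest ⟩
    (likelihood (X ⊓ Y) K K * length K ^ length K) * (likelihood (Z ⊓ (X ⊓ Y)) O O * likelihood Z O O)
      ≡⟨ interchange *-commutativeSemigroup (likelihood (X ⊓ Y) K K) _ (likelihood (Z ⊓ (X ⊓ Y)) O O) _ ⟩
    (likelihood (X ⊓ Y) K K * likelihood (Z ⊓ (X ⊓ Y)) O O) * (length K ^ length K * likelihood Z O O)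
      ≡⟨ cong₂ _*_ (likelihood-⊓-splitOff Z (X ⊓ Y) v L′) (likelihood-splitOff Z v L′ L′) ⟨
    likelihood (Z ⊓ (X ⊓ Y)) L′ L′ * likelihood Z L′ L′ ∎
    where
    L′ K O : List A
    L′ = v ∷ L
    K = classOf Z v L′
    O = outside Z v L′

-- Labeled trees

module _ {σ : ℕ} where

  degree : NodeInfo σ → ℕ
  degree = proj₂ ∘ proj₂

  byContext byLabel byDegree : BoolEquivalence (NodeInfo σ)
  byContext = kernel proj₁ (≡-dec _≟F_)
  byLabel   = kernel (proj₁ ∘ proj₂) _≟F_
  byDegree  = kernel degree _≟ℕ_

  mutual
    degrees-nodesT : ∀ k k′ anc anc′ (t : Tree (Fin σ)) →
                     map degree (nodesT k anc t) ≡ map degree (nodesT k′ anc′ t)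
    degrees-nodesT k k′ anc anc′ (node a ts) =
      cong (length ts ∷_) (degrees-nodesF k k′ (a ∷ anc) (a ∷ anc′) ts)

    degrees-nodesF : ∀ k k′ anc anc′ (ts : List (Tree (Fin σ))) →
                     map degree (nodesF k anc ts) ≡ map degree (nodesF k′ anc′ ts)
    degrees-nodesF k k′ anc anc′ []       = refl
    degrees-nodesF k k′ anc anc′ (t ∷ ts) = ≡.trans (map-++ degree (nodesT k anc t) _) (≡.trans
      (cong₂ _++_ (degrees-nodesT k k′ anc anc′ t) (degrees-nodesF k k′ anc anc′ ts))
      (≡.sym (map-++ degree (nodesT k′ anc′ t) _)))

  length-nodes : ∀ k k′ T → length (nodes k T) ≡ length (nodes k′ T)
  length-nodes k k′ T = begin-equality
    length (nodes k T)               ≡⟨ length-map degree (nodes k T) ⟨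
    length (map degree (nodes k T))   ≡⟨ cong length (degrees-nodesT k k′ [] [] T) ⟩
    length (map degree (nodes k′ T))  ≡⟨ length-map degree (nodes k′ T) ⟩
    length (nodes k′ T)              ∎

  likelihood-byDegree-nodes : ∀ k k′ T →
    likelihood byDegree (nodes k T) (nodes k T) ≡ likelihood byDegree (nodes k′ T) (nodes k′ T)
  likelihood-byDegree-nodes k k′ T = begin-equality
    likelihood byDegree (nodes k T) (nodes k T)
      ≡⟨ likelihood-kernel degree _≟ℕ_ (nodes k T) (nodes k T) ⟩
    likelihood byDegree′ (map degree (nodes k T)) (map degree (nodes k T))
      ≡⟨ cong (λ ds → likelihood byDegree′ ds ds) (degrees-nodesT k k′ [] [] T) ⟩
    likelihood byDegree′ (map degree (nodes k′ T)) (map degree (nodes k′ T))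
      ≡⟨ likelihood-kernel degree _≟ℕ_ (nodes k′ T) (nodes k′ T) ⟨
    likelihood byDegree (nodes k′ T) (nodes k′ T) ∎
    where
    byDegree′ : BoolEquivalence ℕ
    byDegree′ = kernel id _≟ℕ_

mainTheorem1 : ∀ {σ : ℕ} (T : Tree (Fin σ)) (k : ℕ)
    → (exp2-HT T ≤F exp2-HkT∣L k T) × (exp2-HkL k T ≤F exp2-HkL∣T k T)
mainTheorem1 {σ} T k = entropyBound , conditionalEntropyBound
  where
  ns ns₀ : List (NodeInfo σ)
  ns = nodes k T
  ns₀ = nodes 0 T

  entropyBound : exp2-HT T ≤F exp2-HkT∣L k T
  entropyBound = begin
    likelihood byDegree ns₀ ns₀ * likelihood (byContext ⊓ byLabel) ns ns
      ≡⟨ cong (_* likelihood (byContext ⊓ byLabel) ns ns) (likelihood-byDegree-nodes 0 k T) ⟩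
    likelihood byDegree ns ns * likelihood (byContext ⊓ byLabel) ns ns
      ≤⟨ subadditivity byDegree (byContext ⊓ byLabel) ns ns ⟩
    likelihood (byDegree ⊓ (byContext ⊓ byLabel)) ns ns * length ns ^ length ns
      ≡⟨ cong₂ _*_ (likelihood-cong (byDegree ⊓ (byContext ⊓ byLabel)) (byContext ⊓ (byLabel ⊓ byDegree))
                      (λ v w → ∧-rotate (test byDegree v w) (test byContext v w) (test byLabel v w)) ns ns)
                   (cong (λ n → n ^ n) (length-nodes k 0 T)) ⟩
    likelihood (byContext ⊓ (byLabel ⊓ byDegree)) ns ns * length ns₀ ^ length ns₀ ∎
    where open BoolEquivalence renaming (_==_ to test)

  conditionalEntropyBound : exp2-HkL k T ≤F exp2-HkL∣T k T
  conditionalEntropyBound = strongSubadditivity byContext byLabel byDegree ns
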